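{- For all non-negative integers $m$ and $n$: (a) $\mathcal{T}_{m}\mathcal{T}_{n}=\mathcal{T}_{m+n}=\mathcal{T}_{n}\mathcal{T}_{m}$; (b) $\mathcal{T}_{m}\mathcal{K}_{n}=\mathcal{K}_{n}\mathcal{T}_{m}=\mathcal{K}_{m+n}$; (c) $\mathcal{K}_{m}\mathcal{K}_{n}=\mathcal{K}_{n}\mathcal{K}_{m}=9\mathcal{T}_{m+n+2}-12\mathcal{T}_{m+n+1}-2\mathcal{T}_{m+n}+4\mathcal{T}_{m+n-1}+\mathcal{T}_{m+n-2}$; (d) $\mathcal{K}_{m}\mathcal{K}_{n}=\mathcal{K}_{n}\mathcal{K}_{m}=\mathcal{T}_{m+n}+4\mathcal{T}_{m+n-1}+10\mathcal{T}_{m+n-2}+12\mathcal{T}_{m+n-3}+9\mathcal{T}_{m+n-4}$; (e) $\mathcal{K}_{m}\mathcal{K}_{n}=\mathcal{K}_{n}\mathcal{K}_{m}=\mathcal{T}_{m+n}-8\mathcal{T}_{m+n+1}+18\mathcal{T}_{m+n+2}-8\mathcal{T}_{m+n+3}+\mathcal{T}_{m+n+4}$.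
   Context: The Tribonacci matrix sequence $(\mathcal{T}_n)_{n\in\mathbb{Z}}$ and Tribonacci–Lucas matrix sequence $(\mathcal{K}_n)_{n\in\mathbb{Z}}$ of $3\times 3$ matrices are defined by $\mathcal{T}_n=\mathcal{T}_{n-1}+\mathcal{T}_{n-2}+\mathcal{T}_{n-3}$ and $\mathcal{K}_n=\mathcal{K}_{n-1}+\mathcal{K}_{n-2}+\mathcal{K}_{n-3}$ for all integers $n$ (negative indices obtained by running the recurrence backwards: $\mathcal{T}_{ -n}=-\mathcal{T}_{ -(n-1)}-\mathcal{T}_{ -(n-2)}+\mathcal{T}_{ -(n-3)}$, likewise for $\mathcal{K}$), with $\mathcal{T}_0=\begin{pmatrix}1&0&0\\0&1&0\\0&0&1\end{pmatrix}$, $\mathcal{T}_1=\begin{pmatrix}1&1&1\\1&0&0\\0&1&0\end{pmatrix}$, $\mathcal{T}_2=\begin{pmatrix}2&2&1\\1&1&1\\1&0&0\end{pmatrix}$, and $\mathcal{K}_0=\begin{pmatrix}1&2&3\\3&-2&-1\\-1&4&-1\end{pmatrix}$, $\mathcal{K}_1=\begin{pmatrix}3&4&1\\1&2&3\\3&-2&-1\end{pmatrix}$, $\mathcal{K}_2=\begin{pmatrix}7&4&3\\3&4&1\\1&2&3\end{pmatrix}$. -}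

module Defs where

open import Data.Nat using (ℕ; zero; suc)
open import Data.Integer using (ℤ; +_; -[1+_]; _+_; _-_; _*_; -_)
open import Data.Fin using (Fin; zero; suc)
open import Relation.Binary.PropositionalEquality using (_≡_)

-- 3×3 integer matrices, as functions (row index, column index)
Mat : Set
Mat = Fin 3 → Fin 3 → ℤ

mat : ℤ → ℤ → ℤ → ℤ → ℤ → ℤ → ℤ → ℤ → ℤ → Mat
mat a b c d e f g h i zero          zero          = a
mat a b c d e f g h i zero          (suc zero)    = b
mat a b c d e f g h i zero          (suc (suc _)) = c
mat a b c d e f g h i (suc zero)    zero          = d
mat a b c d e f g h i (suc zero)    (suc zero)    = e
mat a b c d e f g h i (suc zero)    (suc (suc _)) = f
mat a b c d e f g h i (suc (suc _)) zero          = g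
mat a b c d e f g h i (suc (suc _)) (suc zero)    = h
mat a b c d e f g h i (suc (suc _)) (suc (suc _)) = i

infixl 6 _⊕_ _⊖_
infixl 7 _⊗_ _·_
infix 4 _≈_

_⊕_ : Mat → Mat → Mat
(A ⊕ B) i j = A i j + B i j

_⊖_ : Mat → Mat → Mat
(A ⊖ B) i j = A i j - B i j

_·_ : ℤ → Mat → Mat
(k · A) i j = k * A i j

_⊗_ : Mat → Mat → Mat
(A ⊗ B) i j = A i zero * B zero j + A i (suc zero) * B (suc zero) j
            + A i (suc (suc zero)) * B (suc (suc zero)) j

_≈_ : Mat → Mat → Set
A ≈ B = ∀ i j → A i j ≡ B i j

-- A sequence (a_n)_{n ∈ ℤ} with a_n = a_{n-1}+a_{n-2}+a_{n-3}, given a_0, a_1, a_2.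
-- Forward part: fwd k = a_k.
fwd : Mat → Mat → Mat → ℕ → Mat
fwd a0 a1 a2 zero                = a0
fwd a0 a1 a2 (suc zero)          = a1
fwd a0 a1 a2 (suc (suc zero))    = a2
fwd a0 a1 a2 (suc (suc (suc k))) =
  fwd a0 a1 a2 (suc (suc k)) ⊕ fwd a0 a1 a2 (suc k) ⊕ fwd a0 a1 a2 k

-- Backward part: bwd k = a_{2-k}, using a_{j-3} = a_j - a_{j-1} - a_{j-2}.
bwd : Mat → Mat → Mat → ℕ → Mat
bwd a0 a1 a2 zero                = a2
bwd a0 a1 a2 (suc zero)          = a1
bwd a0 a1 a2 (suc (suc zero))    = a0
bwd a0 a1 a2 (suc (suc (suc k))) =
  bwd a0 a1 a2 k ⊖ bwd a0 a1 a2 (suc k) ⊖ bwd a0 a1 a2 (suc (suc k))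

seqℤ : Mat → Mat → Mat → ℤ → Mat
seqℤ a0 a1 a2 (+ n)    = fwd a0 a1 a2 n
seqℤ a0 a1 a2 -[1+ n ] = bwd a0 a1 a2 (suc (suc (suc n)))   -- a_{-(n+1)} = a_{2-(n+3)}

𝒯 : ℤ → Mat
𝒯 = seqℤ (mat (+ 1) (+ 0) (+ 0)  (+ 0) (+ 1) (+ 0)  (+ 0) (+ 0) (+ 1))
         (mat (+ 1) (+ 1) (+ 1)  (+ 1) (+ 0) (+ 0)  (+ 0) (+ 1) (+ 0))
         (mat (+ 2) (+ 2) (+ 1)  (+ 1) (+ 1) (+ 1)  (+ 1) (+ 0) (+ 0))

𝒦 : ℤ → Mat
𝒦 = seqℤ (mat (+ 1) (+ 2) (+ 3)  (+ 3) (- (+ 2)) (- (+ 1))  (- (+ 1)) (+ 4) (- (+ 1)))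
         (mat (+ 3) (+ 4) (+ 1)  (+ 1) (+ 2) (+ 3)  (+ 3) (- (+ 2)) (- (+ 1)))
         (mat (+ 7) (+ 4) (+ 3)  (+ 3) (+ 4) (+ 1)  (+ 1) (+ 2) (+ 3))

-- Each side of each identity satisfies the Tribonacci recurrence in m and in n: the products
-- because matrix multiplication is bilinear, the right-hand sides because they are linear
-- combinations of shifts of 𝒯 (here the recurrence is needed at negative indices too).  A
-- solution of the recurrence is determined by three consecutive terms, so each identity
-- reduces to the nine cases m, n ∈ {0, 1, 2}, which are checked by evaluation.
module Submission where

open import Defs
open import Data.Nat using (ℕ)
open import Data.Integer using (ℤ; +_; -_; _+_; _-_)
open import Data.Product using (_×_)

import Data.Nat as ℕ
import Data.Nat.Properties as ℕ
open import Data.Nat using (zero; suc)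
open import Data.Integer using (-[1+_]; _*_)
import Data.Integer.Properties as ℤ
open import Data.Integer.Tactic.RingSolver using (solve-∀)
open import Data.Fin using (Fin; zero; suc; toℕ)
open import Data.Fin.Properties using (all?)
open import Data.Product using (_,_)
open import Relation.Nullary.Decidable using (Dec; True; toWitness)
open import Relation.Binary.PropositionalEquality using (_≡_; refl; sym; trans; cong; cong₂)

≈-refl : {A : Mat} → A ≈ A
≈-refl i j = refl

≈-sym : {A B : Mat} → A ≈ B → B ≈ A
≈-sym p i j = sym (p i j)

≈-trans : {A B C : Mat} → A ≈ B → B ≈ C → A ≈ C
≈-trans p q i j = trans (p i j) (q i j)

≈-reflexive : {A B : Mat} → A ≡ B → A ≈ B
≈-reflexive refl = ≈-refl

infix 4 _≈?_

_≈?_ : (A B : Mat) → Dec (A ≈ B)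
A ≈? B = all? λ i → all? λ j → A i j ℤ.≟ B i j

⊕-cong : {A A′ B B′ : Mat} → A ≈ A′ → B ≈ B′ → A ⊕ B ≈ A′ ⊕ B′
⊕-cong p q i j = cong₂ _+_ (p i j) (q i j)

⊗-congˡ : (X : Mat) {A B : Mat} → A ≈ B → X ⊗ A ≈ X ⊗ B
⊗-congˡ X p i j =
  cong₂ _+_ (cong₂ _+_ (cong (X i zero *_) (p zero j)) (cong (X i (suc zero) *_) (p (suc zero) j)))
            (cong (X i (suc (suc zero)) *_) (p (suc (suc zero)) j))

⊗-congʳ : (X : Mat) {A B : Mat} → A ≈ B → A ⊗ X ≈ B ⊗ X
⊗-congʳ X p i j =
  cong₂ _+_ (cong₂ _+_ (cong (_* X zero j) (p i zero)) (cong (_* X (suc zero) j) (p i (suc zero))))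
            (cong (_* X (suc (suc zero)) j) (p i (suc (suc zero))))

private
  dot-distribˡ-+ : ∀ x₀ x₁ x₂ a₀ a₁ a₂ b₀ b₁ b₂ →
    x₀ * (a₀ + b₀) + x₁ * (a₁ + b₁) + x₂ * (a₂ + b₂)
      ≡ (x₀ * a₀ + x₁ * a₁ + x₂ * a₂) + (x₀ * b₀ + x₁ * b₁ + x₂ * b₂)
  dot-distribˡ-+ = solve-∀

  dot-distribʳ-+ : ∀ x₀ x₁ x₂ a₀ a₁ a₂ b₀ b₁ b₂ →
    (a₀ + b₀) * x₀ + (a₁ + b₁) * x₁ + (a₂ + b₂) * x₂
      ≡ (a₀ * x₀ + a₁ * x₁ + a₂ * x₂) + (b₀ * x₀ + b₁ * x₁ + b₂ * x₂)
  dot-distribʳ-+ = solve-∀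

⊗-distribˡ-⊕ : (X A B : Mat) → X ⊗ (A ⊕ B) ≈ X ⊗ A ⊕ X ⊗ B
⊗-distribˡ-⊕ X A B i j =
  dot-distribˡ-+ (X i zero) (X i (suc zero)) (X i (suc (suc zero)))
                 (A zero j) (A (suc zero) j) (A (suc (suc zero)) j)
                 (B zero j) (B (suc zero) j) (B (suc (suc zero)) j)

⊗-distribʳ-⊕ : (X A B : Mat) → (A ⊕ B) ⊗ X ≈ A ⊗ X ⊕ B ⊗ X
⊗-distribʳ-⊕ X A B i j =
  dot-distribʳ-+ (X zero j) (X (suc zero) j) (X (suc (suc zero)) j)
                 (A i zero) (A i (suc zero)) (A i (suc (suc zero)))
                 (B i zero) (B i (suc zero)) (B i (suc (suc zero)))

record IsTribonacci (f : ℕ → Mat) : Set where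
  constructor tribonacci
  field step : ∀ k → f (3 ℕ.+ k) ≈ f (2 ℕ.+ k) ⊕ f (1 ℕ.+ k) ⊕ f k

open IsTribonacci

module _ {f g : ℕ → Mat} (rf : IsTribonacci f) (rg : IsTribonacci g)
         (agree : ∀ (a : Fin 3) → f (toℕ a) ≈ g (toℕ a)) where

  tribonacci-unique : ∀ n → f n ≈ g n
  tribonacci-unique 0 = agree zero
  tribonacci-unique 1 = agree (suc zero)
  tribonacci-unique 2 = agree (suc (suc zero))
  tribonacci-unique (suc (suc (suc k))) =
    ≈-trans (step rf k)
      (≈-trans (⊕-cong (⊕-cong (tribonacci-unique (suc (suc k))) (tribonacci-unique (suc k)))
                       (tribonacci-unique k))
               (≈-sym (step rg k)))

tribonacci-unique₂ : {f g : ℕ → ℕ → Mat} →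
                     (∀ m → IsTribonacci (f m)) → (∀ n → IsTribonacci (λ m → f m n)) →
                     (∀ m → IsTribonacci (g m)) → (∀ n → IsTribonacci (λ m → g m n)) →
                     (∀ (a b : Fin 3) → f (toℕ a) (toℕ b) ≈ g (toℕ a) (toℕ b)) →
                     ∀ m n → f m n ≈ g m n
tribonacci-unique₂ rf₁ rf₂ rg₁ rg₂ agree m =
  tribonacci-unique (rf₁ m) (rg₁ m) λ b →
    tribonacci-unique (rf₂ (toℕ b)) (rg₂ (toℕ b)) (λ a → agree a b) m

tribonacci-shiftˡ : {f : ℕ → Mat} → IsTribonacci f → ∀ m → IsTribonacci (λ n → f (m ℕ.+ n))
tribonacci-shiftˡ {f} rf m = tribonacci λ k →
  ≈-trans (≈-reflexive (cong f (swap k 3)))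
    (≈-trans (step rf (m ℕ.+ k))
      (⊕-cong (⊕-cong (≈-reflexive (cong f (sym (swap k 2)))) (≈-reflexive (cong f (sym (swap k 1)))))
              ≈-refl))
  where
  swap : ∀ k d → m ℕ.+ (d ℕ.+ k) ≡ d ℕ.+ (m ℕ.+ k)
  swap k d = trans (sym (ℕ.+-assoc m d k)) (trans (cong (ℕ._+ k) (ℕ.+-comm m d)) (ℕ.+-assoc d m k))

tribonacci-shiftʳ : {f : ℕ → Mat} → IsTribonacci f → ∀ n → IsTribonacci (λ m → f (m ℕ.+ n))
tribonacci-shiftʳ rf n = tribonacci λ k → step rf (k ℕ.+ n)

⊗-tribonacciˡ : (X : Mat) {f : ℕ → Mat} → IsTribonacci f → IsTribonacci (λ n → X ⊗ f n)
⊗-tribonacciˡ X {f} rf = tribonacci λ k →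
  ≈-trans (⊗-congˡ X (step rf k))
    (≈-trans (⊗-distribˡ-⊕ X (f (2 ℕ.+ k) ⊕ f (1 ℕ.+ k)) (f k))
             (⊕-cong (⊗-distribˡ-⊕ X (f (2 ℕ.+ k)) (f (1 ℕ.+ k))) ≈-refl))

⊗-tribonacciʳ : (X : Mat) {f : ℕ → Mat} → IsTribonacci f → IsTribonacci (λ n → f n ⊗ X)
⊗-tribonacciʳ X {f} rf = tribonacci λ k →
  ≈-trans (⊗-congʳ X (step rf k))
    (≈-trans (⊗-distribʳ-⊕ X (f (2 ℕ.+ k) ⊕ f (1 ℕ.+ k)) (f k))
             (⊕-cong (⊗-distribʳ-⊕ X (f (2 ℕ.+ k)) (f (1 ℕ.+ k))) ≈-refl))

record ProductLaw (f g h : ℕ → Mat) : Set where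
  constructor productLaw
  field law : ∀ m n → f m ⊗ g n ≈ h (m ℕ.+ n)

open ProductLaw

ProductLawOnSquare : (f g h : ℕ → Mat) → Set
ProductLawOnSquare f g h = ∀ (a b : Fin 3) → f (toℕ a) ⊗ g (toℕ b) ≈ h (toℕ a ℕ.+ toℕ b)

productLawOnSquare? : (f g h : ℕ → Mat) → Dec (ProductLawOnSquare f g h)
productLawOnSquare? f g h = all? λ a → all? λ b → f (toℕ a) ⊗ g (toℕ b) ≈? h (toℕ a ℕ.+ toℕ b)

tribonacci-productLaw : {f g h : ℕ → Mat} → IsTribonacci f → IsTribonacci g → IsTribonacci h →
                        ProductLawOnSquare f g h → ProductLaw f g h
tribonacci-productLaw {f} {g} rf rg rh square = productLaw
  (tribonacci-unique₂ (λ m → ⊗-tribonacciˡ (f m) rg) (λ n → ⊗-tribonacciʳ (g n) rf)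
                      (tribonacci-shiftˡ rh) (tribonacci-shiftʳ rh) square)

productLaw-flipped : {f g h : ℕ → Mat} → ProductLaw f g h → ∀ m n → f n ⊗ g m ≈ h (m ℕ.+ n)
productLaw-flipped {h = h} fg m n = ≈-trans (law fg n m) (≈-reflexive (cong h (ℕ.+-comm n m)))

productLaws-commute : {f g h : ℕ → Mat} → ProductLaw f g h → ProductLaw g f h →
                      ∀ m n → (f m ⊗ g n ≈ g n ⊗ f m) × (g n ⊗ f m ≈ h (m ℕ.+ n))
productLaws-commute fg gf m n =
  ≈-trans (law fg m n) (≈-sym (productLaw-flipped gf m n)) , productLaw-flipped gf m n

record IsTribonacciℤ (φ : ℤ → Mat) : Set where
  constructor tribonacciℤ
  field stepℤ : ∀ z → φ (+ 3 + z) ≈ φ (+ 2 + z) ⊕ φ (+ 1 + z) ⊕ φ z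

open IsTribonacciℤ

tribonacciℤ⇒tribonacci : {φ : ℤ → Mat} → IsTribonacciℤ φ → IsTribonacci (λ n → φ (+ n))
tribonacciℤ⇒tribonacci rφ = tribonacci λ k → stepℤ rφ (+ k)

private
  x≡a+b+[x-a-b] : ∀ x a b → x ≡ a + b + (x - a - b)
  x≡a+b+[x-a-b] = solve-∀

  sum₃-[+]-interchange : ∀ a b c d e f → (a + b + c) + (d + e + f) ≡ (a + d) + (b + e) + (c + f)
  sum₃-[+]-interchange = solve-∀

  sum₃-[-]-interchange : ∀ a b c d e f → (a + b + c) - (d + e + f) ≡ (a - d) + (b - e) + (c - f)
  sum₃-[-]-interchange = solve-∀

  *-distribˡ-sum₃ : ∀ k a b c → k * (a + b + c) ≡ k * a + k * b + k * c
  *-distribˡ-sum₃ k a b c = trans (ℤ.*-distribˡ-+ k (a + b) c) (cong (_+ k * c) (ℤ.*-distribˡ-+ k a b))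

X≈A⊕B⊕[X⊖A⊖B] : (X A B : Mat) → X ≈ A ⊕ B ⊕ (X ⊖ A ⊖ B)
X≈A⊕B⊕[X⊖A⊖B] X A B i j = x≡a+b+[x-a-b] (X i j) (A i j) (B i j)

seqℤ-isTribonacciℤ : (a₀ a₁ a₂ : Mat) → IsTribonacciℤ (seqℤ a₀ a₁ a₂)
seqℤ-isTribonacciℤ a₀ a₁ a₂ = tribonacciℤ recurrence
  where
  φ : ℤ → Mat
  φ = seqℤ a₀ a₁ a₂

  -- For z < 0, φ z unfolds (via bwd) to φ (3 + z) ⊖ φ (2 + z) ⊖ φ (1 + z); the case split on
  -- z below only serves to make + 3 + z compute.
  backward : ∀ z → φ (+ 3 + z) ≈ φ (+ 2 + z) ⊕ φ (+ 1 + z) ⊕ (φ (+ 3 + z) ⊖ φ (+ 2 + z) ⊖ φ (+ 1 + z))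
  backward z = X≈A⊕B⊕[X⊖A⊖B] (φ (+ 3 + z)) (φ (+ 2 + z)) (φ (+ 1 + z))

  recurrence : ∀ z → φ (+ 3 + z) ≈ φ (+ 2 + z) ⊕ φ (+ 1 + z) ⊕ φ z
  recurrence (+ n)                    = ≈-refl
  recurrence -[1+ 0 ]                 = backward -[1+ 0 ]
  recurrence -[1+ 1 ]                 = backward -[1+ 1 ]
  recurrence -[1+ 2 ]                 = backward -[1+ 2 ]
  recurrence -[1+ suc (suc (suc k)) ] = backward -[1+ suc (suc (suc k)) ]

tribonacciℤ-shift : {φ : ℤ → Mat} → IsTribonacciℤ φ → ∀ c → IsTribonacciℤ (λ z → φ (z + c))
tribonacciℤ-shift {φ} rφ c = tribonacciℤ λ z →
  ≈-trans (≈-reflexive (cong φ (ℤ.+-assoc (+ 3) z c)))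
    (≈-trans (stepℤ rφ (z + c))
      (⊕-cong (⊕-cong (≈-reflexive (cong φ (sym (ℤ.+-assoc (+ 2) z c))))
                      (≈-reflexive (cong φ (sym (ℤ.+-assoc (+ 1) z c)))))
              ≈-refl))

infixl 6 _⊕ᵀ_ _⊖ᵀ_
infixl 7 _·ᵀ_

_⊕ᵀ_ : {φ ψ : ℤ → Mat} → IsTribonacciℤ φ → IsTribonacciℤ ψ → IsTribonacciℤ (λ z → φ z ⊕ ψ z)
_⊕ᵀ_ {φ} {ψ} rφ rψ = tribonacciℤ λ z i j →
  trans (cong₂ _+_ (stepℤ rφ z i j) (stepℤ rψ z i j))
        (sum₃-[+]-interchange (φ (+ 2 + z) i j) (φ (+ 1 + z) i j) (φ z i j)
                            (ψ (+ 2 + z) i j) (ψ (+ 1 + z) i j) (ψ z i j))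

_⊖ᵀ_ : {φ ψ : ℤ → Mat} → IsTribonacciℤ φ → IsTribonacciℤ ψ → IsTribonacciℤ (λ z → φ z ⊖ ψ z)
_⊖ᵀ_ {φ} {ψ} rφ rψ = tribonacciℤ λ z i j →
  trans (cong₂ _-_ (stepℤ rφ z i j) (stepℤ rψ z i j))
        (sum₃-[-]-interchange (φ (+ 2 + z) i j) (φ (+ 1 + z) i j) (φ z i j)
                            (ψ (+ 2 + z) i j) (ψ (+ 1 + z) i j) (ψ z i j))

_·ᵀ_ : (k : ℤ) {φ : ℤ → Mat} → IsTribonacciℤ φ → IsTribonacciℤ (λ z → k · φ z)
_·ᵀ_ k {φ} rφ = tribonacciℤ λ z i j →
  trans (cong (k *_) (stepℤ rφ z i j))
        (*-distribˡ-sum₃ k (φ (+ 2 + z) i j) (φ (+ 1 + z) i j) (φ z i j))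

𝒯-isTribonacciℤ : IsTribonacciℤ 𝒯
𝒯-isTribonacciℤ = seqℤ-isTribonacciℤ _ _ _

𝒦-isTribonacciℤ : IsTribonacciℤ 𝒦
𝒦-isTribonacciℤ = seqℤ-isTribonacciℤ _ _ _

𝒯[_] : ∀ c → IsTribonacciℤ (λ z → 𝒯 (z + c))
𝒯[ c ] = tribonacciℤ-shift 𝒯-isTribonacciℤ c

𝒯-isTribonacci : IsTribonacci (λ k → 𝒯 (+ k))
𝒯-isTribonacci = tribonacciℤ⇒tribonacci 𝒯-isTribonacciℤ

𝒦-isTribonacci : IsTribonacci (λ k → 𝒦 (+ k))
𝒦-isTribonacci = tribonacciℤ⇒tribonacci 𝒦-isTribonacciℤ

-- The implicit argument reduces to ⊤ (and is filled in) once the nine initial products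
-- have been compared by evaluation.
productLaw-byEvaluation : {f g h : ℕ → Mat} → IsTribonacci f → IsTribonacci g → IsTribonacci h →
                                {True (productLawOnSquare? f g h)} → ProductLaw f g h
productLaw-byEvaluation rf rg rh {square} = tribonacci-productLaw rf rg rh (toWitness square)

mainTheorem10 : (m n : ℕ) →
    let M = + m
        N = + n
        s = + m + + n
    in
    -- (a)
    ((𝒯 M ⊗ 𝒯 N ≈ 𝒯 s) × (𝒯 s ≈ 𝒯 N ⊗ 𝒯 M))
    -- (b)
    × ((𝒯 M ⊗ 𝒦 N ≈ 𝒦 N ⊗ 𝒯 M) × (𝒦 N ⊗ 𝒯 M ≈ 𝒦 s))
    -- (c)
    × ((𝒦 M ⊗ 𝒦 N ≈ 𝒦 N ⊗ 𝒦 M)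
       × (𝒦 N ⊗ 𝒦 M ≈ + 9 · 𝒯 (s + + 2) ⊖ + 12 · 𝒯 (s + + 1) ⊖ + 2 · 𝒯 s
                        ⊕ + 4 · 𝒯 (s - + 1) ⊕ 𝒯 (s - + 2)))
    -- (d)
    × ((𝒦 M ⊗ 𝒦 N ≈ 𝒦 N ⊗ 𝒦 M)
       × (𝒦 N ⊗ 𝒦 M ≈ 𝒯 s ⊕ + 4 · 𝒯 (s - + 1) ⊕ + 10 · 𝒯 (s - + 2)
                        ⊕ + 12 · 𝒯 (s - + 3) ⊕ + 9 · 𝒯 (s - + 4)))
    -- (e)
    × ((𝒦 M ⊗ 𝒦 N ≈ 𝒦 N ⊗ 𝒦 M)
       × (𝒦 N ⊗ 𝒦 M ≈ 𝒯 s ⊖ + 8 · 𝒯 (s + + 1) ⊕ + 18 · 𝒯 (s + + 2)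
                        ⊖ + 8 · 𝒯 (s + + 3) ⊕ 𝒯 (s + + 4)))
mainTheorem10 m n =
    (law 𝒯𝒯 m n , ≈-sym (productLaw-flipped 𝒯𝒯 m n))
  , productLaws-commute (productLaw-byEvaluation 𝒯-isTribonacci 𝒦-isTribonacci 𝒦-isTribonacci)
                        (productLaw-byEvaluation 𝒦-isTribonacci 𝒯-isTribonacci 𝒦-isTribonacci) m n
  -- The argument of 𝒦𝒦 proves the recurrence for the right-hand side and thereby determines it.
  , 𝒦𝒦 (+ 9 ·ᵀ 𝒯[ + 2 ] ⊖ᵀ + 12 ·ᵀ 𝒯[ + 1 ] ⊖ᵀ + 2 ·ᵀ 𝒯-isTribonacciℤ
          ⊕ᵀ + 4 ·ᵀ 𝒯[ - + 1 ] ⊕ᵀ 𝒯[ - + 2 ])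
  , 𝒦𝒦 (𝒯-isTribonacciℤ ⊕ᵀ + 4 ·ᵀ 𝒯[ - + 1 ] ⊕ᵀ + 10 ·ᵀ 𝒯[ - + 2 ]
          ⊕ᵀ + 12 ·ᵀ 𝒯[ - + 3 ] ⊕ᵀ + 9 ·ᵀ 𝒯[ - + 4 ])
  , 𝒦𝒦 (𝒯-isTribonacciℤ ⊖ᵀ + 8 ·ᵀ 𝒯[ + 1 ] ⊕ᵀ + 18 ·ᵀ 𝒯[ + 2 ]
          ⊖ᵀ + 8 ·ᵀ 𝒯[ + 3 ] ⊕ᵀ 𝒯[ + 4 ])
  where
  𝒯𝒯 : ProductLaw (λ k → 𝒯 (+ k)) (λ k → 𝒯 (+ k)) (λ k → 𝒯 (+ k))
  𝒯𝒯 = productLaw-byEvaluation 𝒯-isTribonacci 𝒯-isTribonacci 𝒯-isTribonacci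

  𝒦𝒦 : {φ : ℤ → Mat} → IsTribonacciℤ φ →
       {True (productLawOnSquare? (λ k → 𝒦 (+ k)) (λ k → 𝒦 (+ k)) (λ k → φ (+ k)))} →
       (𝒦 (+ m) ⊗ 𝒦 (+ n) ≈ 𝒦 (+ n) ⊗ 𝒦 (+ m)) × (𝒦 (+ n) ⊗ 𝒦 (+ m) ≈ φ (+ m + + n))
  𝒦𝒦 {φ} rφ {square} = productLaws-commute 𝒦𝒦-law 𝒦𝒦-law m n
    where
    𝒦𝒦-law : ProductLaw (λ k → 𝒦 (+ k)) (λ k → 𝒦 (+ k)) (λ k → φ (+ k))
    𝒦𝒦-law = productLaw-byEvaluation 𝒦-isTribonacci 𝒦-isTribonacci (tribonacciℤ⇒tribonacci rφ) {square}
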